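{- Let $r$ be a positive integer and let $d=(d_1,\dots,d_n)$ be a degree sequence with $\mathrm{BP}(d)\neq\emptyset$. If $d_1^2\le r\cdot\sum d/2+r$, then every partition $(a,b)\in\mathrm{BP}(d)$ is $r$-max-bigraphic.
   Context: A degree sequence is a non-increasing sequence of positive integers with even sum; $d_1$ is its maximum entry. $\mathrm{BP}(d)$ is the set of pairs $(a,b)$ of complementary subsequences of $d$ with equal sums. Multigraphs are loopless (parallel edges allowed). $(a,b)$ is $r$-max-bigraphic if there is a loopless multigraph with underlying bipartite graph with sides $A,B$, where the degree sequence of $A$ is $a$, that of $B$ is $b$, and every pair of vertices is joined by at most $r$ parallel edges. -}

module Defs where

open import Data.Nat using (ℕ; zero; suc; _+_; _*_; _≤_; _<_; _≥_; _⊔_)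
open import Data.Nat.Divisibility using (_∣_)
open import Data.Bool using (Bool; true; false)
open import Data.Fin using (Fin)
open import Data.List using (List; []; _∷_; length; tabulate; lookup; foldr)
open import Data.Nat.ListAction using (sum)
open import Data.List.Relation.Unary.All using (All)
open import Data.List.Relation.Unary.Linked using (Linked)
open import Data.Vec using (Vec; []; _∷_)
open import Data.Product using (_×_; _,_; Σ; ∃; ∃-syntax)
open import Relation.Binary.PropositionalEquality using (_≡_)

IsDegreeSequence : List ℕ → Set
IsDegreeSequence d = Linked _≥_ d × All (λ x → 0 < x) d × (2 ∣ sum d)

-- maximum entry (= d₁ for a non-increasing sequence; 0 for the empty one)
maxEntry : List ℕ → ℕ
maxEntry = foldr _⊔_ 0

split : (d : List ℕ) → Vec Bool (length d) → List ℕ × List ℕ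
split []       []           = [] , []
split (x ∷ xs) (true  ∷ m) with split xs m
... | a , b = x ∷ a , b
split (x ∷ xs) (false ∷ m) with split xs m
... | a , b = a , x ∷ b

InBP : List ℕ → List ℕ → List ℕ → Set
InBP d a b = Σ (Vec Bool (length d)) λ m → split d m ≡ (a , b) × sum a ≡ sum b

BPNonempty : List ℕ → Set
BPNonempty d = ∃[ a ] ∃[ b ] InBP d a b

-- (a , b) is r-max-bigraphic: there is a loopless bipartite multigraph with
-- sides A = Fin (length a), B = Fin (length b), given by edge multiplicities
-- mult i j ≤ r, whose A-degrees are a and B-degrees are b.
MaxBigraphic : ℕ → List ℕ → List ℕ → Set
MaxBigraphic r a b =
  Σ (Fin (length a) → Fin (length b) → ℕ) λ mult →
    (∀ i j → mult i j ≤ r)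
    × (∀ i → sum (tabulate (λ j → mult i j)) ≡ lookup a i)
    × (∀ j → sum (tabulate (λ i → mult i j)) ≡ lookup b j)

{-# OPTIONS --safe #-}

-- A row sequence a with entries at most D and total m can be realised against column
-- demands b, with every multiplicity at most r, as soon as m ⊓ kD ≤ Σⱼ (bⱼ ⊓ rk) for all k
-- (k rows carry at most m ⊓ kD units, and at most bⱼ ⊓ rk of them can go to column j).
-- The first row is filled greedily, one unit at a time, into a column below the cap with
-- the largest remaining demand; the balance this leaves among the remaining demands is
-- what carries the inequalities over to the remaining rows. For (a, b) ∈ BP(d) all entries
-- are at most D = d₁ and m = Σd/2. If rk < D, truncating at rk keeps at least the fraction
-- rk/D of each bⱼ, so D · Σⱼ (bⱼ ⊓ rk) ≥ rkm, and with D² ≤ rm + r this rules out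
-- Σⱼ (bⱼ ⊓ rk) < kD.

module Submission where

open import Defs
open import Data.Nat using (ℕ; _+_; _*_; _≤_; _/_)
open import Data.List using (List)
open import Data.Nat.ListAction using (sum)

open import Data.Nat using (zero; suc; _∸_; _<_; _⊓_; z≤n; s≤s⁻¹; _≤?_; _<?_)
open import Data.Nat.Properties hiding (_≟_)
open import Data.Nat.DivMod using (m*n/n≡m)
open import Data.Nat.Tactic.RingSolver using (solve-∀)
open import Algebra.Properties.Semiring.Sum +-*-semiring
  using (sum-syntax; sum-cong-≗; sum-replicate-zero; ∑-distrib-+; *-distribˡ-sum)
  renaming (sum to ∑)
open import Algebra.Properties.CommutativeSemigroup +-commutativeSemigroup using (x∙yz≈y∙xz)
open import Data.Bool using (true; false)
open import Data.Fin using (Fin; zero; suc; _≟_)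
open import Data.Fin.Properties using (any?)
open import Data.List using ([]; _∷_; length; lookup; tabulate; allFin)
open import Data.List.Properties using (tabulate-lookup)
open import Data.List.Extrema.Nat using (argmax; f[xs]≤f[argmax])
open import Data.List.Membership.Propositional.Properties using (∈-allFin; ∈-lookup)
open import Data.List.Relation.Unary.All as All using (All; []; _∷_)
open import Data.Vec using ([]; _∷_)
open import Data.Vec.Functional using (Vector; tail; updateAt)
  renaming (_∷_ to _◂_)
open import Data.Vec.Functional.Properties using (updateAt-updates; updateAt-minimal)
open import Data.Product using (_×_; _,_; proj₁; proj₂; map₁; map₂; ∃-syntax)
open import Data.Sum using (_⊎_; inj₁; inj₂)
open import Function using (_∘_)
open import Relation.Binary.PropositionalEquality
open import Relation.Nullary using (yes; no; contradiction)
open import Relation.Nullary.Decidable using (_×-dec_)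

sum-tabulate : ∀ {q} (f : Vector ℕ q) → sum (tabulate f) ≡ ∑ f
sum-tabulate {zero}  f = refl
sum-tabulate {suc q} f = cong (f zero +_) (sum-tabulate (tail f))

∑-mono-≤ : ∀ {q} {f g : Vector ℕ q} → (∀ j → f j ≤ g j) → ∑ f ≤ ∑ g
∑-mono-≤ {zero}  f≤g = z≤n
∑-mono-≤ {suc q} f≤g = +-mono-≤ (f≤g zero) (∑-mono-≤ (f≤g ∘ suc))

f≤∑f : ∀ {q} (f : Vector ℕ q) j → f j ≤ ∑ f
f≤∑f f zero    = m≤m+n (f zero) _
f≤∑f f (suc j) = ≤-trans (f≤∑f (tail f) j) (m≤n+m _ (f zero))

∑<∑⇒∃< : ∀ {q} (f g : Vector ℕ q) → ∑ f < ∑ g → ∃[ j ] f j < g j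
∑<∑⇒∃< f g ∑f<∑g with any? (λ j → f j <? g j)
... | yes f<g = f<g
... | no ¬f<g = contradiction (∑-mono-≤ (λ j → ≮⇒≥ (¬f<g ∘ (j ,_)))) (<⇒≱ ∑f<∑g)

∑-updateAt-suc : ∀ {q} (f : Vector ℕ q) k → ∑ (updateAt f k suc) ≡ suc (∑ f)
∑-updateAt-suc f zero    = refl
∑-updateAt-suc f (suc k) = trans (cong (f zero +_) (∑-updateAt-suc (tail f) k)) (+-suc (f zero) _)

updateAt-preserves : ∀ {A : Set} {q} (P : Fin q → A → Set) (x : Vector A q) k {f : A → A} →
                     P k (f (x k)) → (∀ j → P j (x j)) → ∀ j → P j (updateAt x k f j)
updateAt-preserves P x k Pk P-all j with j ≟ k
... | yes refl = subst (P j) (sym (updateAt-updates j x)) Pk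
... | no j≢k   = subst (P j) (sym (updateAt-minimal j k x j≢k)) (P-all j)

Balanced : ∀ {q} → ℕ → Vector ℕ q → Vector ℕ q → Set
Balanced r b x = ∀ j j′ → 0 < x j → x j′ < r → b j′ ∸ x j′ ≤ suc (b j ∸ x j)

balanced-updateAt : ∀ {r q} {b x : Vector ℕ q} {k} → Balanced r b x → x k < b k →
                    (∀ j → x j < r → b j ∸ x j ≤ b k ∸ x k) →
                    Balanced r b (updateAt x k suc)
balanced-updateAt {r} {b = b} {x} {k} balanced xₖ<bₖ k-maximal j j′ 0<x′ⱼ x′ⱼ′<r
  with j ≟ k | j′ ≟ k
... | yes refl | yes refl = n≤1+n _
... | yes refl | no j′≢k = begin
  b j′ ∸ x′ j′             ≡⟨ cong (b j′ ∸_) x′ⱼ′≡xⱼ′ ⟩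
  b j′ ∸ x j′              ≤⟨ k-maximal j′ (subst (_< r) x′ⱼ′≡xⱼ′ x′ⱼ′<r) ⟩
  b k ∸ x k                ≡⟨ +-∸-assoc 1 xₖ<bₖ ⟩
  suc (b k ∸ suc (x k))    ≡⟨ cong (λ t → suc (b k ∸ t)) (updateAt-updates k x) ⟨
  suc (b k ∸ x′ k)         ∎
  where
  open ≤-Reasoning
  x′ : Vector ℕ _
  x′ = updateAt x k suc
  x′ⱼ′≡xⱼ′ : x′ j′ ≡ x j′
  x′ⱼ′≡xⱼ′ = updateAt-minimal j′ k x j′≢k
... | no j≢k | yes refl = begin
  b k ∸ x′ k               ≡⟨ cong (b k ∸_) (updateAt-updates k x) ⟩
  b k ∸ suc (x k)          ≤⟨ ∸-monoʳ-≤ (b k) (n≤1+n (x k)) ⟩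
  b k ∸ x k                ≤⟨ balanced j k (subst (0 <_) x′ⱼ≡xⱼ 0<x′ⱼ) xₖ<r ⟩
  suc (b j ∸ x j)          ≡⟨ cong (λ t → suc (b j ∸ t)) x′ⱼ≡xⱼ ⟨
  suc (b j ∸ x′ j)         ∎
  where
  open ≤-Reasoning
  x′ : Vector ℕ _
  x′ = updateAt x k suc
  x′ⱼ≡xⱼ : x′ j ≡ x j
  x′ⱼ≡xⱼ = updateAt-minimal j k x j≢k
  xₖ<r : x k < r
  xₖ<r = <-trans (n<1+n (x k)) (subst (_< r) (updateAt-updates k x) x′ⱼ′<r)
... | no j≢k | no j′≢k =
  subst₂ (λ s t → b j′ ∸ s ≤ suc (b j ∸ t)) (sym x′ⱼ′≡xⱼ′) (sym x′ⱼ≡xⱼ)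
    (balanced j j′ (subst (0 <_) x′ⱼ≡xⱼ 0<x′ⱼ) (subst (_< r) x′ⱼ′≡xⱼ′ x′ⱼ′<r))
  where
  x′ⱼ≡xⱼ : updateAt x k suc j ≡ x j
  x′ⱼ≡xⱼ = updateAt-minimal j k x j≢k
  x′ⱼ′≡xⱼ′ : updateAt x k suc j′ ≡ x j′
  x′ⱼ′≡xⱼ′ = updateAt-minimal j′ k x j′≢k

room : ℕ → ℕ → ℕ → ℕ
room r bⱼ xⱼ with xⱼ <? r
... | yes _ = bⱼ ∸ xⱼ
... | no _  = 0

room-open : ∀ {r bⱼ xⱼ} → xⱼ < r → room r bⱼ xⱼ ≡ bⱼ ∸ xⱼ
room-open {r} {bⱼ} {xⱼ} xⱼ<r with xⱼ <? r
... | yes _    = refl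
... | no xⱼ≮r = contradiction xⱼ<r xⱼ≮r

room-pos⇒open : ∀ {r bⱼ xⱼ} → 0 < room r bⱼ xⱼ → xⱼ < r × xⱼ < bⱼ
room-pos⇒open {r} {bⱼ} {xⱼ} 0<room with xⱼ <? r
... | yes xⱼ<r = xⱼ<r , m∸n≢0⇒n<m (m<n⇒n≢0 0<room)
... | no _     = contradiction 0<room (<-irrefl refl)

maxOpenColumn : ∀ r {q} (b x : Vector ℕ q) j₀ → x j₀ < b j₀ ⊓ r →
                ∃[ k ] x k < r × x k < b k × (∀ j → x j < r → b j ∸ x j ≤ b k ∸ x k)
maxOpenColumn r {q} b x j₀ xⱼ₀<bⱼ₀⊓r =
  k , xₖ<r , xₖ<bₖ , λ j xⱼ<r → subst₂ _≤_ (room-open xⱼ<r) (room-open xₖ<r) (w≤wₖ j)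
  where
  w : Vector ℕ q
  w j = room r (b j) (x j)
  k : Fin q
  k = argmax w j₀ (allFin q)
  w≤wₖ : ∀ j → w j ≤ w k
  w≤wₖ j = All.lookup (f[xs]≤f[argmax] {f = w} j₀ (allFin q)) (∈-allFin j)
  0<wⱼ₀ : 0 < w j₀
  0<wⱼ₀ = subst (0 <_) (sym (room-open (m<n⊓o⇒m<o (b j₀) r xⱼ₀<bⱼ₀⊓r)))
            (m<n⇒0<n∸m (m<n⊓o⇒m<n (b j₀) r xⱼ₀<bⱼ₀⊓r))
  k-open : x k < r × x k < b k
  k-open = room-pos⇒open (<-≤-trans 0<wⱼ₀ (w≤wₖ j₀))
  xₖ<r : x k < r
  xₖ<r = proj₁ k-open
  xₖ<bₖ : x k < b k
  xₖ<bₖ = proj₂ k-open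

record GreedyRow {q} (r : ℕ) (b : Vector ℕ q) (s : ℕ) : Set where
  field
    row      : Vector ℕ q
    row≤r    : ∀ j → row j ≤ r
    row≤b    : ∀ j → row j ≤ b j
    ∑row     : ∑ row ≡ s
    balanced : Balanced r b row

module _ {r q} {b : Vector ℕ q} {s} (g : GreedyRow r b s) where
  open GreedyRow g

  extendRow : s < ∑[ j < q ] (b j ⊓ r) → GreedyRow r b (suc s)
  extendRow s<cap with ∑<∑⇒∃< row (λ j → b j ⊓ r) (subst (_< _) (sym ∑row) s<cap)
  ... | j₀ , open-j₀ with maxOpenColumn r b row j₀ open-j₀
  ... | k , xₖ<r , xₖ<bₖ , k-maximal = record
    { row      = updateAt row k suc
    ; row≤r    = updateAt-preserves (λ _ v → v ≤ r) row k xₖ<r row≤r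
    ; row≤b    = updateAt-preserves (λ j v → v ≤ b j) row k xₖ<bₖ row≤b
    ; ∑row     = trans (∑-updateAt-suc row k) (cong suc ∑row)
    ; balanced = balanced-updateAt balanced xₖ<bₖ k-maximal
    }

greedyRow : ∀ r {q} (b : Vector ℕ q) s → s ≤ ∑[ j < q ] (b j ⊓ r) → GreedyRow r b s
greedyRow r {q} b zero _ = record
  { row = λ _ → 0 ; row≤r = λ _ → z≤n ; row≤b = λ _ → z≤n
  ; ∑row = sum-replicate-zero q ; balanced = λ _ _ () }
greedyRow r b (suc s) s<cap = extendRow (greedyRow r b s (<⇒≤ s<cap)) s<cap

GaleRyserCondition : ∀ {q} → ℕ → ℕ → ℕ → Vector ℕ q → Set
GaleRyserCondition {q} r D m b = ∀ k → m ⊓ (k * D) ≤ ∑[ j < q ] (b j ⊓ (r * k))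

⊓-residual : ∀ r c {b x} → b ∸ x ≤ c ⊎ r ≤ x → b ⊓ (r + c) ≤ (b ∸ x) ⊓ c + x
⊓-residual r c {b} {x} b∸x≤c⊎r≤x = begin
  b ⊓ (r + c)             ≤⟨ ⊓-bound b∸x≤c⊎r≤x ⟩
  b ⊓ (c + x)             ≤⟨ ⊓-monoˡ-≤ (c + x) b≤b∸x+x ⟩
  (b ∸ x + x) ⊓ (c + x)   ≡⟨ +-distribʳ-⊓ x (b ∸ x) c ⟨
  (b ∸ x) ⊓ c + x         ∎
  where
  open ≤-Reasoning
  b≤b∸x+x : b ≤ b ∸ x + x
  b≤b∸x+x = ≤-trans (m≤n+m∸n b x) (≤-reflexive (+-comm x (b ∸ x)))
  ⊓-bound : b ∸ x ≤ c ⊎ r ≤ x → b ⊓ (r + c) ≤ b ⊓ (c + x)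
  ⊓-bound (inj₁ b∸x≤c) =
    ≤-trans (m⊓n≤m b (r + c)) (⊓-glb ≤-refl (≤-trans b≤b∸x+x (+-monoˡ-≤ x b∸x≤c)))
  ⊓-bound (inj₂ r≤x)   = ⊓-monoʳ-≤ b (≤-trans (≤-reflexive (+-comm r c)) (+-monoʳ-≤ c r≤x))

residual-saturated : ∀ {r q} {b x : Vector ℕ q} → Balanced r b x → ∀ {c} j′ → x j′ < r →
                     c < b j′ ∸ x j′ → ∑[ j < q ] ((b j ∸ x j) ⊓ c) ≡ ∑[ j < q ] (b j ⊓ c)
residual-saturated {r} {b = b} {x} balanced {c} j′ xⱼ′<r c<residual = sum-cong-≗ column
  where
  column : ∀ j → (b j ∸ x j) ⊓ c ≡ b j ⊓ c
  column j with 0 <? x j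
  ... | yes 0<xⱼ = trans (m≥n⇒m⊓n≡n c≤residual)
                         (sym (m≥n⇒m⊓n≡n (≤-trans c≤residual (m∸n≤m (b j) (x j)))))
    where
    c≤residual : c ≤ b j ∸ x j
    c≤residual = s≤s⁻¹ (<-≤-trans c<residual (balanced j j′ 0<xⱼ xⱼ′<r))
  ... | no 0≮xⱼ = cong (λ t → (b j ∸ t) ⊓ c) (n≤0⇒n≡0 (≮⇒≥ 0≮xⱼ))

residual-unsaturated : ∀ {r q} (b x : Vector ℕ q) c → (∀ j → x j < r → b j ∸ x j ≤ c) →
                       ∑[ j < q ] (b j ⊓ (r + c)) ≤ ∑[ j < q ] ((b j ∸ x j) ⊓ c) + ∑ x
residual-unsaturated {r} b x c open⇒residual≤c = begin
  ∑ (λ j → b j ⊓ (r + c))              ≤⟨ ∑-mono-≤ (λ j → ⊓-residual r c (column j)) ⟩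
  ∑ (λ j → (b j ∸ x j) ⊓ c + x j)      ≡⟨ ∑-distrib-+ (λ j → (b j ∸ x j) ⊓ c) x ⟩
  ∑ (λ j → (b j ∸ x j) ⊓ c) + ∑ x      ∎
  where
  open ≤-Reasoning
  column : ∀ j → b j ∸ x j ≤ c ⊎ r ≤ x j
  column j with x j <? r
  ... | yes xⱼ<r = inj₁ (open⇒residual≤c j xⱼ<r)
  ... | no xⱼ≮r  = inj₂ (≮⇒≥ xⱼ≮r)

condition-residual : ∀ {r D q a₁ m} {b x : Vector ℕ q} → Balanced r b x → ∑ x ≡ a₁ → a₁ ≤ D →
                     GaleRyserCondition r D (a₁ + m) b →
                     GaleRyserCondition r D m (λ j → b j ∸ x j)
condition-residual {r} {D} {q} {a₁} {m} {b} {x} balanced ∑x≡a₁ a₁≤D cond k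
  with any? (λ j → x j <? r ×-dec r * k <? b j ∸ x j)
... | yes (j′ , xⱼ′<r , rk<residual) = begin
  m ⊓ (k * D)                          ≤⟨ ⊓-monoˡ-≤ (k * D) (m≤n+m m a₁) ⟩
  (a₁ + m) ⊓ (k * D)                   ≤⟨ cond k ⟩
  ∑[ j < q ] (b j ⊓ (r * k))           ≡⟨ residual-saturated balanced j′ xⱼ′<r rk<residual ⟨
  ∑[ j < q ] ((b j ∸ x j) ⊓ (r * k))   ∎
  where open ≤-Reasoning
... | no ¬saturated = +-cancelˡ-≤ a₁ _ _ (begin
  a₁ + m ⊓ (k * D)                          ≡⟨ +-distribˡ-⊓ a₁ m (k * D) ⟩
  (a₁ + m) ⊓ (a₁ + k * D)                   ≤⟨ ⊓-monoʳ-≤ (a₁ + m) (+-monoˡ-≤ (k * D) a₁≤D) ⟩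
  (a₁ + m) ⊓ (suc k * D)                    ≤⟨ cond (suc k) ⟩
  ∑[ j < q ] (b j ⊓ (r * suc k))            ≡⟨ sum-cong-≗ (λ j → cong (b j ⊓_) (*-suc r k)) ⟩
  ∑[ j < q ] (b j ⊓ (r + r * k))            ≤⟨ residual-unsaturated b x (r * k) open⇒residual≤rk ⟩
  ∑[ j < q ] ((b j ∸ x j) ⊓ (r * k)) + ∑ x  ≡⟨ cong (_ +_) ∑x≡a₁ ⟩
  ∑[ j < q ] ((b j ∸ x j) ⊓ (r * k)) + a₁   ≡⟨ +-comm _ a₁ ⟩
  a₁ + ∑[ j < q ] ((b j ∸ x j) ⊓ (r * k))   ∎)
  where
  open ≤-Reasoning
  open⇒residual≤rk : ∀ j → x j < r → b j ∸ x j ≤ r * k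
  open⇒residual≤rk j xⱼ<r = ≮⇒≥ (¬saturated ∘ (j ,_) ∘ (xⱼ<r ,_))

record Realization {q} (r : ℕ) (a : List ℕ) (b : Vector ℕ q) : Set where
  constructor realization
  field
    mult     : Fin (length a) → Vector ℕ q
    mult≤r   : ∀ i j → mult i j ≤ r
    row-sums : ∀ i → ∑ (mult i) ≡ lookup a i
    col-sums : ∀ j → ∑[ i < length a ] mult i j ≡ b j

prependRow : ∀ {r q a₁ as} {b x : Vector ℕ q} → (∀ j → x j ≤ r) → (∀ j → x j ≤ b j) →
             ∑ x ≡ a₁ → Realization r as (λ j → b j ∸ x j) → Realization r (a₁ ∷ as) b
prependRow {x = x} x≤r x≤b ∑x≡a₁ (realization M M≤r rows cols) = realization
  (x ◂ M)
  (λ { zero → x≤r ; (suc i) → M≤r i })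
  (λ { zero → ∑x≡a₁ ; (suc i) → rows i })
  (λ j → trans (cong (x j +_) (cols j)) (m+[n∸m]≡n (x≤b j)))

condition⇒realization : ∀ r D {q} (a : List ℕ) (b : Vector ℕ q) → All (_≤ D) a → ∑ b ≡ sum a →
                        GaleRyserCondition r D (sum a) b → Realization r a b
condition⇒realization r D [] b _ ∑b≡0 _ =
  realization (λ ()) (λ ()) (λ ()) (λ j → sym (n≤0⇒n≡0 (subst (b j ≤_) ∑b≡0 (f≤∑f b j))))
condition⇒realization r D {q} (a₁ ∷ as) b (a₁≤D ∷ as≤D) ∑b≡a cond =
  prependRow row≤r row≤b ∑row
    (condition⇒realization r D as (λ j → b j ∸ row j) as≤D ∑residual
      (condition-residual balanced ∑row a₁≤D cond))
  where
  open ≤-Reasoning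
  first-row-fits : a₁ ≤ ∑[ j < q ] (b j ⊓ r)
  first-row-fits = begin
    a₁                            ≤⟨ ⊓-glb (m≤m+n a₁ (sum as)) (≤-trans a₁≤D (m≤m+n D 0)) ⟩
    (a₁ + sum as) ⊓ (1 * D)       ≤⟨ cond 1 ⟩
    ∑[ j < q ] (b j ⊓ (r * 1))    ≡⟨ sum-cong-≗ (λ j → cong (b j ⊓_) (*-identityʳ r)) ⟩
    ∑[ j < q ] (b j ⊓ r)          ∎
  open GreedyRow (greedyRow r b a₁ first-row-fits)
  ∑residual : ∑[ j < q ] (b j ∸ row j) ≡ sum as
  ∑residual = +-cancelʳ-≡ a₁ _ _ (begin-equality
    ∑[ j < q ] (b j ∸ row j) + a₁        ≡⟨ cong (∑[ j < q ] (b j ∸ row j) +_) ∑row ⟨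
    ∑[ j < q ] (b j ∸ row j) + ∑ row     ≡⟨ ∑-distrib-+ (λ j → b j ∸ row j) row ⟨
    ∑[ j < q ] (b j ∸ row j + row j)     ≡⟨ sum-cong-≗ (λ j → m∸n+n≡m (row≤b j)) ⟩
    ∑ b                                  ≡⟨ ∑b≡a ⟩
    a₁ + sum as                          ≡⟨ +-comm a₁ (sum as) ⟩
    sum as + a₁                          ∎)

*-⊓-bound : ∀ {c D b} → c ≤ D → b ≤ D → c * b ≤ D * (b ⊓ c)
*-⊓-bound {c} {D} {b} c≤D b≤D = begin
  c * b                 ≤⟨ ⊓-glb (*-monoˡ-≤ b c≤D) c*b≤D*c ⟩
  (D * b) ⊓ (D * c)     ≡⟨ *-distribˡ-⊓ D b c ⟨
  D * (b ⊓ c)           ∎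
  where
  open ≤-Reasoning
  c*b≤D*c : c * b ≤ D * c
  c*b≤D*c = ≤-trans (*-monoʳ-≤ c b≤D) (≤-reflexive (*-comm c D))

square-bound⇒condition : ∀ r {D m q} (b : Vector ℕ q) → (∀ j → b j ≤ D) → ∑ b ≡ m →
                          D * D ≤ r * m + r → GaleRyserCondition r D m b
square-bound⇒condition r {D} {m} {q} b b≤D ∑b≡m D²≤rm+r k with D ≤? r * k
... | yes D≤rk = begin
  m ⊓ (k * D)                  ≤⟨ m⊓n≤m m (k * D) ⟩
  m                            ≡⟨ ∑b≡m ⟨
  ∑ b                          ≡⟨ sum-cong-≗ (λ j → m≤n⇒m⊓n≡m (≤-trans (b≤D j) D≤rk)) ⟨
  ∑[ j < q ] (b j ⊓ (r * k))   ∎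
  where open ≤-Reasoning
... | no D≰rk = ≤-trans (m⊓n≤n m (k * D)) (≮⇒≥ (D≰rk ∘ short⇒D≤rk))
  where
  open ≤-Reasoning
  φ : ℕ
  φ = ∑[ j < q ] (b j ⊓ (r * k))
  averaging : r * k * m ≤ D * φ
  averaging = begin
    r * k * m                          ≡⟨ cong (r * k *_) ∑b≡m ⟨
    r * k * ∑ b                        ≡⟨ *-distribˡ-sum (r * k) b ⟩
    ∑[ j < q ] (r * k * b j)           ≤⟨ ∑-mono-≤ (λ j → *-⊓-bound (<⇒≤ (≰⇒> D≰rk)) (b≤D j)) ⟩
    ∑[ j < q ] (D * (b j ⊓ (r * k)))   ≡⟨ *-distribˡ-sum D (λ j → b j ⊓ (r * k)) ⟨
    D * φ                              ∎
  distribute : ∀ k r m → k * (r * m + r) ≡ r * k * m + r * k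
  distribute = solve-∀
  short⇒D≤rk : φ < k * D → D ≤ r * k
  short⇒D≤rk φ<kD = +-cancelˡ-≤ (D * φ) _ _ (begin
    D * φ + D              ≡⟨ +-comm (D * φ) D ⟩
    D + D * φ              ≡⟨ *-suc D φ ⟨
    D * suc φ              ≤⟨ *-monoʳ-≤ D φ<kD ⟩
    D * (k * D)            ≡⟨ trans (*-comm D (k * D)) (*-assoc k D D) ⟩
    k * (D * D)            ≤⟨ *-monoʳ-≤ k D²≤rm+r ⟩
    k * (r * m + r)        ≡⟨ distribute k r m ⟩
    r * k * m + r * k      ≤⟨ +-monoˡ-≤ (r * k) averaging ⟩
    D * φ + r * k          ∎)

xs≤maxEntry : ∀ xs → All (_≤ maxEntry xs) xs
xs≤maxEntry []       = []
xs≤maxEntry (x ∷ xs) =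
  m≤m⊔n x (maxEntry xs) ∷ All.map (λ y≤max → ≤-trans y≤max (m≤n⊔m x (maxEntry xs))) (xs≤maxEntry xs)

sum-split : ∀ d m → sum d ≡ sum (proj₁ (split d m)) + sum (proj₂ (split d m))
sum-split []       []          = refl
sum-split (x ∷ xs) (mₓ ∷ m) = trans (cong (x +_) (sum-split xs m)) (move x mₓ)
  where
  Σa Σb : ℕ
  Σa = sum (proj₁ (split xs m))
  Σb = sum (proj₂ (split xs m))
  move : ∀ x mₓ → x + (Σa + Σb) ≡
                  sum (proj₁ (split (x ∷ xs) (mₓ ∷ m))) + sum (proj₂ (split (x ∷ xs) (mₓ ∷ m)))
  move x true  = sym (+-assoc x Σa Σb)
  move x false = x∙yz≈y∙xz x Σa Σb

All-split : ∀ {P : ℕ → Set} d m → All P d → All P (proj₁ (split d m)) × All P (proj₂ (split d m))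
All-split []       []          []         = [] , []
All-split (x ∷ xs) (true ∷ m)  (px ∷ pxs) = map₁ (px ∷_) (All-split xs m pxs)
All-split (x ∷ xs) (false ∷ m) (px ∷ pxs) = map₂ (px ∷_) (All-split xs m pxs)

[m+m]/2≡m : ∀ m → (m + m) / 2 ≡ m
[m+m]/2≡m m = trans (cong (_/ 2) (m+m≡m*2 m)) (m*n/n≡m m 2)
  where
  m+m≡m*2 : ∀ m → m + m ≡ m * 2
  m+m≡m*2 = solve-∀

Realization⇒MaxBigraphic : ∀ {r a} b → Realization r a (lookup b) → MaxBigraphic r a b
Realization⇒MaxBigraphic b (realization M M≤r rows cols) =
  M , M≤r , (λ i → trans (sum-tabulate (M i)) (rows i)) ,
  (λ j → trans (sum-tabulate (λ i → M i j)) (cols j))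

corollary38 : (r : ℕ) → 1 ≤ r → (d : List ℕ) → IsDegreeSequence d → BPNonempty d
    → maxEntry d * maxEntry d ≤ r * (sum d / 2) + r
    → ∀ a b → InBP d a b → MaxBigraphic r a b
corollary38 r _ d _ _ D²≤r[Σd/2]+r a b (mask , refl , Σa≡Σb) =
  Realization⇒MaxBigraphic b
    (condition⇒realization r D a (lookup b) a≤D ∑b≡Σa
      (square-bound⇒condition r (lookup b) b≤D ∑b≡Σa D²≤rΣa+r))
  where
  D : ℕ
  D = maxEntry d
  a≤D : All (_≤ D) a
  a≤D = proj₁ (All-split d mask (xs≤maxEntry d))
  b≤D : ∀ j → lookup b j ≤ D
  b≤D j = All.lookup (proj₂ (All-split d mask (xs≤maxEntry d))) (∈-lookup j)
  ∑b≡Σa : ∑ (lookup b) ≡ sum a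
  ∑b≡Σa = trans (sym (sum-tabulate (lookup b))) (trans (cong sum (tabulate-lookup b)) (sym Σa≡Σb))
  Σd/2≡Σa : sum d / 2 ≡ sum a
  Σd/2≡Σa = trans (cong (_/ 2) (trans (sum-split d mask) (cong (sum a +_) (sym Σa≡Σb))))
                  ([m+m]/2≡m (sum a))
  D²≤rΣa+r : D * D ≤ r * sum a + r
  D²≤rΣa+r = subst (λ t → D * D ≤ r * t + r) Σd/2≡Σa D²≤r[Σd/2]+r
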